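{- For every closed typable term $M$ of $T^{\mathtt R}$, all $m,n\in\mathbb N$ and every value $V$ of $T^{\mathtt R}$, $[\![M]\!](V)\ge\sum_{m',n'}[\![(M^*,m,n)]\!](V^*,m',n')$.
   Context: Types $\sigma,\tau::=\mathbb N\mid\sigma\to\tau\mid\sigma\times\tau$; $T^{\mathtt R}$ terms $M,N::=x\mid\lambda x.M\mid MN\mid\langle M,N\rangle\mid\pi_1\mid\pi_2\mid\mathtt{rec}\mid\mathtt 0\mid\mathtt S\mid\mathtt R$, simply typed with $\mathtt 0:\mathbb N$, $\mathtt S:\mathbb N\to\mathbb N$, $\mathtt{rec}:(\sigma\times(\mathbb N\to\sigma\to\sigma)\times\mathbb N)\to\sigma$, $\pi_1:(\sigma\times\tau)\to\sigma$, $\pi_2:(\sigma\times\tau)\to\tau$, $\mathtt R:\mathbb N$. Numerals $\mathbf 0=\mathtt 0$, $\mathbf{n+1}=\mathtt S\mathbf n$. Values: closed terms of $V,W::=\lambda x.M\mid\pi_1\mid\pi_2\mid\langle V,W\rangle\mid\mathtt{rec}\mid\mathtt 0\mid\mathtt S\mid\mathtt SV$. Weak call-by-value reduction to (sub)distributions: $(\lambda x.M)V\to\{M[V/x]\}$; if $M\to\mu$ then $MV\to\mu V$ (pushforward); if $N\to\nu$ then $MN\to M\nu$; pairs left then right; $\mathtt{rec}\langle U,V,\mathtt 0\rangle\to\{U\}$; $\mathtt{rec}\langle U,V,\mathtt S\mathbf k\rangle\to\{V\mathbf k(\mathtt{rec}\langle U,V,\mathbf k\rangle)\}$; projections of pairs;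 $\mathtt R\to\{\mathbf k\mapsto2^{ -(k+1)}\}_k$; lifted to distributions; $[\![M]\!](V)=\lim_j\mu_j(V)$ with $\mu_0=\{M\}$, $\mu_{j+1}$ the reduct of $\mu_j$. State-bounded calculus: add constant $\mathtt{SR}:\mathbb N$, $M^*=M[\mathtt{SR}/\mathtt R]$; configurations $(M^*,m,n)$ reduce by the same rules with the state $(m,n)$ unchanged, except $(\mathtt{SR},m,n)\to\{(\mathbf k,m+n,n)\mapsto2^{ -(k+1)}\mid k<m\}$; lifted to distributions; $[\![(M^*,m,n)]\!]$ is the limit subdistribution over value configurations. -}

module Defs where

open import Data.Nat using (ℕ; zero; suc; _+_; _∸_; _<ᵇ_; _≡ᵇ_)
open import Data.Bool using (Bool; true; false; if_then_else_; _∧_)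
open import Data.Maybe using (Maybe; just; nothing)
open import Data.List using (List; []; _∷_)
open import Data.Product using (Σ; _×_; _,_)
open import Data.Rational using (ℚ; 0ℚ; 1ℚ; ½) renaming (_+_ to _+ℚ_; _*_ to _*ℚ_)
open import Relation.Binary.PropositionalEquality using (_≡_)

data Ty : Set where
  nat  : Ty
  _⇒_  : Ty → Ty → Ty
  _⊗_  : Ty → Ty → Ty

infixr 5 _⇒_
infixr 6 _⊗_

-- One syntax for both calculi: T^R terms are those without `SR`;
-- state-bounded terms are those without `R`.
data Tm : Set where
  var  : ℕ → Tm
  lam  : Tm → Tm
  app  : Tm → Tm → Tm
  pair : Tm → Tm → Tm
  p1 p2 recT zeroT sucT R SR : Tm

num : ℕ → Tm
num zero    = zeroT
num (suc n) = app sucT (num n)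

-- Typing of T^R (no rule for SR, so typable terms are T^R terms)

Ctx : Set
Ctx = List Ty

data _∋_∶_ : Ctx → ℕ → Ty → Set where
  here  : ∀ {Γ σ} → (σ ∷ Γ) ∋ zero ∶ σ
  there : ∀ {Γ σ τ x} → Γ ∋ x ∶ σ → (τ ∷ Γ) ∋ suc x ∶ σ

data _⊢_∶_ : Ctx → Tm → Ty → Set where
  ⊢var  : ∀ {Γ x σ} → Γ ∋ x ∶ σ → Γ ⊢ var x ∶ σ
  ⊢lam  : ∀ {Γ M σ τ} → (σ ∷ Γ) ⊢ M ∶ τ → Γ ⊢ lam M ∶ (σ ⇒ τ)
  ⊢app  : ∀ {Γ M N σ τ} → Γ ⊢ M ∶ (σ ⇒ τ) → Γ ⊢ N ∶ σ → Γ ⊢ app M N ∶ τ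
  ⊢pair : ∀ {Γ M N σ τ} → Γ ⊢ M ∶ σ → Γ ⊢ N ∶ τ → Γ ⊢ pair M N ∶ (σ ⊗ τ)
  ⊢p1   : ∀ {Γ σ τ} → Γ ⊢ p1 ∶ ((σ ⊗ τ) ⇒ σ)
  ⊢p2   : ∀ {Γ σ τ} → Γ ⊢ p2 ∶ ((σ ⊗ τ) ⇒ τ)
  ⊢rec  : ∀ {Γ σ} → Γ ⊢ recT ∶ ((σ ⊗ ((nat ⇒ σ ⇒ σ) ⊗ nat)) ⇒ σ)
  ⊢zero : ∀ {Γ} → Γ ⊢ zeroT ∶ nat
  ⊢suc  : ∀ {Γ} → Γ ⊢ sucT ∶ (nat ⇒ nat)
  ⊢R    : ∀ {Γ} → Γ ⊢ R ∶ nat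

ClosedTypable : Tm → Set
ClosedTypable M = Σ Ty (λ σ → [] ⊢ M ∶ σ)

boundBy : ℕ → Tm → Bool
boundBy d (var x)    = x <ᵇ d
boundBy d (lam M)    = boundBy (suc d) M
boundBy d (app M N)  = boundBy d M ∧ boundBy d N
boundBy d (pair M N) = boundBy d M ∧ boundBy d N
boundBy d _          = true

noSR : Tm → Bool
noSR (lam M)    = noSR M
noSR (app M N)  = noSR M ∧ noSR N
noSR (pair M N) = noSR M ∧ noSR N
noSR SR         = false
noSR _          = true

isValue : Tm → Bool
isValue (lam M)         = true
isValue p1              = true
isValue p2              = true
isValue (pair M N)      = isValue M ∧ isValue N
isValue recT            = true
isValue zeroT           = true
isValue sucT            = true
isValue (app sucT V)    = isValue V
isValue _               = false

IsValueTR : Tm → Set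
IsValueTR V = (isValue V ≡ true) × (boundBy 0 V ≡ true) × (noSR V ≡ true)

star : Tm → Tm
star (lam M)    = lam (star M)
star (app M N)  = app (star M) (star N)
star (pair M N) = pair (star M) (star N)
star R          = SR
star M          = M

eqTm : Tm → Tm → Bool
eqTm (var x) (var y)         = x ≡ᵇ y
eqTm (lam M) (lam N)         = eqTm M N
eqTm (app M N) (app M' N')   = eqTm M M' ∧ eqTm N N'
eqTm (pair M N) (pair M' N') = eqTm M M' ∧ eqTm N N'
eqTm p1 p1       = true
eqTm p2 p2       = true
eqTm recT recT   = true
eqTm zeroT zeroT = true
eqTm sucT sucT   = true
eqTm R R         = true
eqTm SR SR       = true
eqTm _ _         = false

-- substitution of a closed term V for variable i (de Bruijn)
subst : ℕ → Tm → Tm → Tm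
subst i V (var x)    = if x <ᵇ i then var x else (if x ≡ᵇ i then V else var (x ∸ 1))
subst i V (lam M)    = lam (subst (suc i) V M)
subst i V (app M N)  = app (subst i V M) (subst i V N)
subst i V (pair M N) = pair (subst i V M) (subst i V N)
subst i V M          = M

asNum : Tm → Maybe ℕ
asNum zeroT        = just zero
asNum (app sucT t) with asNum t
... | just k  = just (suc k)
... | nothing = nothing
asNum _            = nothing

-- One step of weak call-by-value reduction (argument first, pairs
-- left then right).  Random constants produce a family indexed by the
-- sampled k (the reduct is the term with the numeral k plugged in).

data Step : Set where
  val    : Step
  stuck  : Step
  det    : Tm → Step
  sampR  : (ℕ → Tm) → Step      -- R-sampling: k ↦ term, prob 2^-(k+1)
  sampSR : (ℕ → Tm) → Step      -- SR-sampling (state-dependent)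

mapS : (Tm → Tm) → Step → Step
mapS f val        = stuck
mapS f stuck      = stuck
mapS f (det M)    = det (f M)
mapS f (sampR g)  = sampR (λ k → f (g k))
mapS f (sampSR g) = sampSR (λ k → f (g k))

recStep : Tm → Tm → Maybe ℕ → Step
recStep U V nothing        = stuck
recStep U V (just zero)    = det U
recStep U V (just (suc k)) = det (app (app V (num k)) (app recT (pair U (pair V (num k)))))

redex : Tm → Tm → Step
redex (lam B) V                   = det (subst 0 V B)
redex p1 (pair V W)               = det V
redex p2 (pair V W)               = det W
redex recT (pair U (pair V n))    = recStep U V (asNum n)
redex _ _                         = stuck

step : Tm → Step
step (var x)    = stuck
step (lam M)    = val
step (app M N)  =
  if isValue (app M N) then val
  else (if isValue N
        then (if isValue M then redex M N else mapS (λ X → app X N) (step M))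
        else mapS (app M) (step N))
step (pair M N) =
  if isValue M
  then (if isValue N then val else mapS (pair M) (step N))
  else mapS (λ X → pair X N) (step M)
step p1    = val
step p2    = val
step recT  = val
step zeroT = val
step sucT  = val
step R     = sampR num
step SR    = sampSR num

sumBelow : ℕ → (ℕ → ℚ) → ℚ
sumBelow zero    f = 0ℚ
sumBelow (suc n) f = sumBelow n f +ℚ f n

halfPow : ℕ → ℚ
halfPow zero    = ½
halfPow (suc k) = ½ *ℚ halfPow k

indicator : Bool → ℚ
indicator true  = 1ℚ
indicator false = 0ℚ

-- T^R semantics, approximated.
-- muR j N M V = μ_j(V) restricted to runs in which every R-sample is < N.
-- For each fixed j, μ_j(V) = sup_N muR j N M V, and [[M]](V) = sup_j μ_j(V)
-- (values are kept by the lifting, so μ_j(V) is nondecreasing in j).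

muR : ℕ → ℕ → Tm → Tm → ℚ
muR zero    N M V = indicator (eqTm M V)
muR (suc j) N M V with step M
... | val       = muR j N M V
... | stuck     = 0ℚ
... | det M'    = muR j N M' V
... | sampR g   = sumBelow N (λ k → halfPow k *ℚ muR j N (g k) V)
... | sampSR g  = 0ℚ

-- State-bounded semantics.
-- muSB j M m n V m' n' = μ_j(V,m',n') where μ_0 = {(M,m,n)}.
-- [[ (M,m,n) ]](V,m',n') = sup_j muSB j M m n V m' n'.

muSB : ℕ → Tm → ℕ → ℕ → Tm → ℕ → ℕ → ℚ
muSB zero    M m n V m' n' = indicator (eqTm M V ∧ (m ≡ᵇ m') ∧ (n ≡ᵇ n'))
muSB (suc j) M m n V m' n' with step M
... | val       = muSB j M m n V m' n'
... | stuck     = 0ℚ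
... | det M'    = muSB j M' m n V m' n'
... | sampR g   = 0ℚ
... | sampSR g  = sumBelow m (λ k → halfPow k *ℚ muSB j (g k) (m + n) n V m' n')

-- Reduction of M* from state (m , n) runs in lockstep with reduction of
-- M, SR-samples matching R-samples; an SR-sample in state (m , n) is some
-- k < m and moves the state to (m + n , n). Hence in j steps every sample
-- drawn is below m + j * n, and the state-bounded run is a sub-run of the
-- T^R run in which all samples lie below that bound. Each run ends in exactly
-- one state, so summing over final states (m′ , n′) loses nothing, and the
-- bound already holds with ε = 0.
module Submission where

open import Defs
open import Data.Nat using (ℕ)
open import Data.Product using (∃-syntax)
open import Data.Rational using (ℚ; 0ℚ; _≤_; _<_; _+_)

open import Algebra.Bundles using (CommutativeMonoid)
open import Data.Bool using (true; false; _∧_)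
open import Data.Bool.Properties using (∧-conicalˡ; ∧-conicalʳ; T-≡)
open import Data.Maybe using (just; nothing)
open import Data.Nat as ℕ using (zero; suc; _<ᵇ_; _≡ᵇ_)
import Data.Nat.Properties as ℕ
open import Data.Product using (_,_)
open import Data.Rational using (1ℚ; ½; nonNegative) renaming (_*_ to _*ℚ_)
open import Data.Rational.Properties
  using ( ≤-refl; ≤-reflexive; ≤-trans; <⇒≤; +-mono-≤; +-monoʳ-≤; *-monoˡ-≤-nonNeg
        ; +-identityˡ; +-identityʳ; *-zeroʳ; *-distribˡ-+; nonNegative⁻¹; nonNeg*nonNeg⇒nonNeg
        ; +-0-commutativeMonoid)
  renaming (module ≤-Reasoning to ℚ-≤-Reasoning)
open import Algebra.Properties.CommutativeSemigroup
  (CommutativeMonoid.commutativeSemigroup +-0-commutativeMonoid) using (interchange)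
open import Function.Bundles using (Equivalence)
open import Relation.Binary.PropositionalEquality
  using (_≡_; refl; sym; trans; cong; cong₂; module ≡-Reasoning)
  renaming (subst to ≡-subst)

∧-intro : ∀ {a b} → a ≡ true → b ≡ true → a ∧ b ≡ true
∧-intro refl refl = refl

eqTm-sound : ∀ M V → eqTm M V ≡ true → M ≡ V
eqTm-sound (var x) (var x′) e = cong var (ℕ.≡ᵇ⇒≡ x x′ (Equivalence.from T-≡ e))
eqTm-sound (var _) (lam _) ()
eqTm-sound (var _) (app _ _) ()
eqTm-sound (var _) (pair _ _) ()
eqTm-sound (var _) p1 ()
eqTm-sound (var _) p2 ()
eqTm-sound (var _) recT ()
eqTm-sound (var _) zeroT ()
eqTm-sound (var _) sucT ()
eqTm-sound (var _) R ()
eqTm-sound (var _) SR ()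
eqTm-sound (lam _) (var _) ()
eqTm-sound (lam A) (lam A′) e = cong lam (eqTm-sound A A′ e)
eqTm-sound (lam _) (app _ _) ()
eqTm-sound (lam _) (pair _ _) ()
eqTm-sound (lam _) p1 ()
eqTm-sound (lam _) p2 ()
eqTm-sound (lam _) recT ()
eqTm-sound (lam _) zeroT ()
eqTm-sound (lam _) sucT ()
eqTm-sound (lam _) R ()
eqTm-sound (lam _) SR ()
eqTm-sound (app _ _) (var _) ()
eqTm-sound (app _ _) (lam _) ()
eqTm-sound (app A B) (app A′ B′) e = cong₂ app (eqTm-sound A A′ (∧-conicalˡ _ _ e)) (eqTm-sound B B′ (∧-conicalʳ _ _ e))
eqTm-sound (app _ _) (pair _ _) ()
eqTm-sound (app _ _) p1 ()
eqTm-sound (app _ _) p2 ()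
eqTm-sound (app _ _) recT ()
eqTm-sound (app _ _) zeroT ()
eqTm-sound (app _ _) sucT ()
eqTm-sound (app _ _) R ()
eqTm-sound (app _ _) SR ()
eqTm-sound (pair _ _) (var _) ()
eqTm-sound (pair _ _) (lam _) ()
eqTm-sound (pair _ _) (app _ _) ()
eqTm-sound (pair A B) (pair A′ B′) e = cong₂ pair (eqTm-sound A A′ (∧-conicalˡ _ _ e)) (eqTm-sound B B′ (∧-conicalʳ _ _ e))
eqTm-sound (pair _ _) p1 ()
eqTm-sound (pair _ _) p2 ()
eqTm-sound (pair _ _) recT ()
eqTm-sound (pair _ _) zeroT ()
eqTm-sound (pair _ _) sucT ()
eqTm-sound (pair _ _) R ()
eqTm-sound (pair _ _) SR ()
eqTm-sound p1 (var _) ()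
eqTm-sound p1 (lam _) ()
eqTm-sound p1 (app _ _) ()
eqTm-sound p1 (pair _ _) ()
eqTm-sound p1 p1 e = refl
eqTm-sound p1 p2 ()
eqTm-sound p1 recT ()
eqTm-sound p1 zeroT ()
eqTm-sound p1 sucT ()
eqTm-sound p1 R ()
eqTm-sound p1 SR ()
eqTm-sound p2 (var _) ()
eqTm-sound p2 (lam _) ()
eqTm-sound p2 (app _ _) ()
eqTm-sound p2 (pair _ _) ()
eqTm-sound p2 p1 ()
eqTm-sound p2 p2 e = refl
eqTm-sound p2 recT ()
eqTm-sound p2 zeroT ()
eqTm-sound p2 sucT ()
eqTm-sound p2 R ()
eqTm-sound p2 SR ()
eqTm-sound recT (var _) ()
eqTm-sound recT (lam _) ()
eqTm-sound recT (app _ _) ()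
eqTm-sound recT (pair _ _) ()
eqTm-sound recT p1 ()
eqTm-sound recT p2 ()
eqTm-sound recT recT e = refl
eqTm-sound recT zeroT ()
eqTm-sound recT sucT ()
eqTm-sound recT R ()
eqTm-sound recT SR ()
eqTm-sound zeroT (var _) ()
eqTm-sound zeroT (lam _) ()
eqTm-sound zeroT (app _ _) ()
eqTm-sound zeroT (pair _ _) ()
eqTm-sound zeroT p1 ()
eqTm-sound zeroT p2 ()
eqTm-sound zeroT recT ()
eqTm-sound zeroT zeroT e = refl
eqTm-sound zeroT sucT ()
eqTm-sound zeroT R ()
eqTm-sound zeroT SR ()
eqTm-sound sucT (var _) ()
eqTm-sound sucT (lam _) ()
eqTm-sound sucT (app _ _) ()
eqTm-sound sucT (pair _ _) ()
eqTm-sound sucT p1 ()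
eqTm-sound sucT p2 ()
eqTm-sound sucT recT ()
eqTm-sound sucT zeroT ()
eqTm-sound sucT sucT e = refl
eqTm-sound sucT R ()
eqTm-sound sucT SR ()
eqTm-sound R (var _) ()
eqTm-sound R (lam _) ()
eqTm-sound R (app _ _) ()
eqTm-sound R (pair _ _) ()
eqTm-sound R p1 ()
eqTm-sound R p2 ()
eqTm-sound R recT ()
eqTm-sound R zeroT ()
eqTm-sound R sucT ()
eqTm-sound R R e = refl
eqTm-sound R SR ()
eqTm-sound SR (var _) ()
eqTm-sound SR (lam _) ()
eqTm-sound SR (app _ _) ()
eqTm-sound SR (pair _ _) ()
eqTm-sound SR p1 ()
eqTm-sound SR p2 ()
eqTm-sound SR recT ()
eqTm-sound SR zeroT ()
eqTm-sound SR sucT ()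
eqTm-sound SR R ()
eqTm-sound SR SR e = refl

eqTm-refl : ∀ M → eqTm M M ≡ true
eqTm-refl (var x)    = Equivalence.to T-≡ (ℕ.≡⇒≡ᵇ x x refl)
eqTm-refl (lam M)    = eqTm-refl M
eqTm-refl (app M N)  = ∧-intro (eqTm-refl M) (eqTm-refl N)
eqTm-refl (pair M N) = ∧-intro (eqTm-refl M) (eqTm-refl N)
eqTm-refl p1    = refl
eqTm-refl p2    = refl
eqTm-refl recT  = refl
eqTm-refl zeroT = refl
eqTm-refl sucT  = refl
eqTm-refl R     = refl
eqTm-refl SR    = refl

unstar : Tm → Tm
unstar (lam M)    = lam (unstar M)
unstar (app M N)  = app (unstar M) (unstar N)
unstar (pair M N) = pair (unstar M) (unstar N)
unstar SR         = R
unstar M          = M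

unstar-star : ∀ M → noSR M ≡ true → unstar (star M) ≡ M
unstar-star (var x)    _ = refl
unstar-star (lam M)    h = cong lam (unstar-star M h)
unstar-star (app M N)  h = cong₂ app (unstar-star M (∧-conicalˡ _ _ h)) (unstar-star N (∧-conicalʳ _ _ h))
unstar-star (pair M N) h = cong₂ pair (unstar-star M (∧-conicalˡ _ _ h)) (unstar-star N (∧-conicalʳ _ _ h))
unstar-star p1    _ = refl
unstar-star p2    _ = refl
unstar-star recT  _ = refl
unstar-star zeroT _ = refl
unstar-star sucT  _ = refl
unstar-star R     _ = refl
unstar-star SR    ()

star-injective : ∀ {M V} → noSR M ≡ true → noSR V ≡ true → star M ≡ star V → M ≡ V
star-injective {M} {V} hM hV e = begin
  M                ≡⟨ sym (unstar-star M hM) ⟩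
  unstar (star M)  ≡⟨ cong unstar e ⟩
  unstar (star V)  ≡⟨ unstar-star V hV ⟩
  V                ∎
  where open ≡-Reasoning

eqTm-star⇒eqTm : ∀ {M V} → noSR M ≡ true → noSR V ≡ true → eqTm (star M) (star V) ≡ true → eqTm M V ≡ true
eqTm-star⇒eqTm {M} {V} hM hV e =
  ≡-subst (λ X → eqTm X V ≡ true) (sym (star-injective {M} {V} hM hV (eqTm-sound (star M) (star V) e))) (eqTm-refl V)

isValue-star : ∀ M → isValue (star M) ≡ isValue M
isValue-star (var x)    = refl
isValue-star (lam M)    = refl
isValue-star (pair M N) = cong₂ _∧_ (isValue-star M) (isValue-star N)
isValue-star (app sucT N)       = isValue-star N
isValue-star (app (var _) _)    = refl
isValue-star (app (lam _) _)    = refl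
isValue-star (app (app _ _) _)  = refl
isValue-star (app (pair _ _) _) = refl
isValue-star (app p1 _)    = refl
isValue-star (app p2 _)    = refl
isValue-star (app recT _)  = refl
isValue-star (app zeroT _) = refl
isValue-star (app R _)     = refl
isValue-star (app SR _)    = refl
isValue-star p1    = refl
isValue-star p2    = refl
isValue-star recT  = refl
isValue-star zeroT = refl
isValue-star sucT  = refl
isValue-star R     = refl
isValue-star SR    = refl

asNum-star : ∀ M → asNum (star M) ≡ asNum M
asNum-star (app sucT N) rewrite asNum-star N = refl
asNum-star (var _)            = refl
asNum-star (lam _)            = refl
asNum-star (pair _ _)         = refl
asNum-star (app (var _) _)    = refl
asNum-star (app (lam _) _)    = refl
asNum-star (app (app _ _) _)  = refl
asNum-star (app (pair _ _) _) = refl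
asNum-star (app p1 _)    = refl
asNum-star (app p2 _)    = refl
asNum-star (app recT _)  = refl
asNum-star (app zeroT _) = refl
asNum-star (app R _)     = refl
asNum-star (app SR _)    = refl
asNum-star p1    = refl
asNum-star p2    = refl
asNum-star recT  = refl
asNum-star zeroT = refl
asNum-star sucT  = refl
asNum-star R     = refl
asNum-star SR    = refl

star-num : ∀ k → star (num k) ≡ num k
star-num zero    = refl
star-num (suc k) = cong (app sucT) (star-num k)

noSR-num : ∀ k → noSR (num k) ≡ true
noSR-num zero    = refl
noSR-num (suc k) = noSR-num k

star-subst : ∀ i V M → star (subst i V M) ≡ subst i (star V) (star M)
star-subst i V (var x) with x <ᵇ i
... | true = refl
... | false with x ≡ᵇ i
...   | true  = refl
...   | false = refl
star-subst i V (lam M)    = cong lam (star-subst (suc i) V M)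
star-subst i V (app M N)  = cong₂ app (star-subst i V M) (star-subst i V N)
star-subst i V (pair M N) = cong₂ pair (star-subst i V M) (star-subst i V N)
star-subst i V p1    = refl
star-subst i V p2    = refl
star-subst i V recT  = refl
star-subst i V zeroT = refl
star-subst i V sucT  = refl
star-subst i V R     = refl
star-subst i V SR    = refl

noSR-subst : ∀ i V M → noSR V ≡ true → noSR M ≡ true → noSR (subst i V M) ≡ true
noSR-subst i V (var x) hV _ with x <ᵇ i
... | true = refl
... | false with x ≡ᵇ i
...   | true  = hV
...   | false = refl
noSR-subst i V (lam M)    hV hM = noSR-subst (suc i) V M hV hM
noSR-subst i V (app M N)  hV hM =
  ∧-intro (noSR-subst i V M hV (∧-conicalˡ _ _ hM)) (noSR-subst i V N hV (∧-conicalʳ _ _ hM))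
noSR-subst i V (pair M N) hV hM =
  ∧-intro (noSR-subst i V M hV (∧-conicalˡ _ _ hM)) (noSR-subst i V N hV (∧-conicalʳ _ _ hM))
noSR-subst i V p1    _ _ = refl
noSR-subst i V p2    _ _ = refl
noSR-subst i V recT  _ _ = refl
noSR-subst i V zeroT _ _ = refl
noSR-subst i V sucT  _ _ = refl
noSR-subst i V R     _ _ = refl
noSR-subst i V SR    _ ()

⊢⇒noSR : ∀ {Γ M σ} → Γ ⊢ M ∶ σ → noSR M ≡ true
⊢⇒noSR (⊢var _)     = refl
⊢⇒noSR (⊢lam d)     = ⊢⇒noSR d
⊢⇒noSR (⊢app d e)   = ∧-intro (⊢⇒noSR d) (⊢⇒noSR e)
⊢⇒noSR (⊢pair d e)  = ∧-intro (⊢⇒noSR d) (⊢⇒noSR e)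
⊢⇒noSR ⊢p1   = refl
⊢⇒noSR ⊢p2   = refl
⊢⇒noSR ⊢rec  = refl
⊢⇒noSR ⊢zero = refl
⊢⇒noSR ⊢suc  = refl
⊢⇒noSR ⊢R    = refl

-- One reduction step commutes with M ↦ M*

data StarStep : Step → Step → Set where
  val*   : StarStep val val
  stuck* : StarStep stuck stuck
  det*   : ∀ {M M′} → M′ ≡ star M → noSR M ≡ true → StarStep (det M) (det M′)
  samp*  : ∀ {g h} → (∀ k → h k ≡ star (g k)) → (∀ k → noSR (g k) ≡ true) →
           StarStep (sampR g) (sampSR h)

mapS-star : ∀ {s s′} (f f′ : Tm → Tm) → (∀ X → f′ (star X) ≡ star (f X)) →
  (∀ X → noSR X ≡ true → noSR (f X) ≡ true) → StarStep s s′ → StarStep (mapS f s) (mapS f′ s′)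
mapS-star f f′ f* hf val*                 = stuck*
mapS-star f f′ f* hf stuck*               = stuck*
mapS-star f f′ f* hf (det* {M} refl hM)   = det* (f* M) (hf M hM)
mapS-star f f′ f* hf (samp* {g} g* hg)    =
  samp* (λ k → trans (cong f′ (g* k)) (f* (g k))) (λ k → hf (g k) (hg k))

recStep-star : ∀ U V n → noSR U ≡ true → noSR V ≡ true →
  StarStep (recStep U V (asNum n)) (recStep (star U) (star V) (asNum (star n)))
recStep-star U V n hU hV rewrite asNum-star n with asNum n
... | nothing      = stuck*
... | just zero    = det* refl hU
... | just (suc k) =
  det* (cong (λ x → app (app (star V) x) (app recT (pair (star U) (pair (star V) x)))) (sym (star-num k)))
       (∧-intro (∧-intro hV (noSR-num k)) (∧-intro hU (∧-intro hV (noSR-num k))))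

redex-star : ∀ M N → noSR M ≡ true → noSR N ≡ true → StarStep (redex M N) (redex (star M) (star N))
redex-star (lam B) N hM hN = det* (sym (star-subst 0 N B)) (noSR-subst 0 N B hN hM)
redex-star p1 (pair _ _) _ hN = det* refl (∧-conicalˡ _ _ hN)
redex-star p1 (var _)    _ _ = stuck*
redex-star p1 (lam _)    _ _ = stuck*
redex-star p1 (app _ _)  _ _ = stuck*
redex-star p1 p1    _ _ = stuck*
redex-star p1 p2    _ _ = stuck*
redex-star p1 recT  _ _ = stuck*
redex-star p1 zeroT _ _ = stuck*
redex-star p1 sucT  _ _ = stuck*
redex-star p1 R     _ _ = stuck*
redex-star p1 SR    _ _ = stuck*
redex-star p2 (pair _ _) _ hN = det* refl (∧-conicalʳ _ _ hN)
redex-star p2 (var _)    _ _ = stuck*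
redex-star p2 (lam _)    _ _ = stuck*
redex-star p2 (app _ _)  _ _ = stuck*
redex-star p2 p1    _ _ = stuck*
redex-star p2 p2    _ _ = stuck*
redex-star p2 recT  _ _ = stuck*
redex-star p2 zeroT _ _ = stuck*
redex-star p2 sucT  _ _ = stuck*
redex-star p2 R     _ _ = stuck*
redex-star p2 SR    _ _ = stuck*
redex-star recT (pair U (pair V n)) _ hN =
  recStep-star U V n (∧-conicalˡ _ _ hN) (∧-conicalˡ _ _ (∧-conicalʳ (noSR U) _ hN))
redex-star recT (pair _ (var _))    _ _ = stuck*
redex-star recT (pair _ (lam _))    _ _ = stuck*
redex-star recT (pair _ (app _ _))  _ _ = stuck*
redex-star recT (pair _ p1)    _ _ = stuck*
redex-star recT (pair _ p2)    _ _ = stuck*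
redex-star recT (pair _ recT)  _ _ = stuck*
redex-star recT (pair _ zeroT) _ _ = stuck*
redex-star recT (pair _ sucT)  _ _ = stuck*
redex-star recT (pair _ R)     _ _ = stuck*
redex-star recT (pair _ SR)    _ _ = stuck*
redex-star recT (var _)   _ _ = stuck*
redex-star recT (lam _)   _ _ = stuck*
redex-star recT (app _ _) _ _ = stuck*
redex-star recT p1    _ _ = stuck*
redex-star recT p2    _ _ = stuck*
redex-star recT recT  _ _ = stuck*
redex-star recT zeroT _ _ = stuck*
redex-star recT sucT  _ _ = stuck*
redex-star recT R     _ _ = stuck*
redex-star recT SR    _ _ = stuck*
redex-star (var _)    _ _ _ = stuck*
redex-star (app _ _)  _ _ _ = stuck*
redex-star (pair _ _) _ _ _ = stuck*
redex-star zeroT      _ _ _ = stuck*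
redex-star sucT       _ _ _ = stuck*
redex-star R          _ _ _ = stuck*
redex-star SR         _ () _

step-star : ∀ M → noSR M ≡ true → StarStep (step M) (step (star M))
step-star (var x) _ = stuck*
step-star (lam M) _ = val*
step-star (app M N) h
  rewrite isValue-star (app M N) | isValue-star N | isValue-star M
  with isValue (app M N) | isValue N | isValue M
... | true  | _     | _     = val*
... | false | true  | true  = redex-star M N hM hN
  where hM = ∧-conicalˡ _ _ h; hN = ∧-conicalʳ _ _ h
... | false | true  | false =
  mapS-star (λ X → app X N) (λ X → app X (star N)) (λ _ → refl)
            (λ _ hX → ∧-intro hX (∧-conicalʳ _ _ h)) (step-star M (∧-conicalˡ _ _ h))
... | false | false | _     =
  mapS-star (app M) (app (star M)) (λ _ → refl)
            (λ _ hX → ∧-intro (∧-conicalˡ _ _ h) hX) (step-star N (∧-conicalʳ _ _ h))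
step-star (pair M N) h
  rewrite isValue-star M | isValue-star N
  with isValue M | isValue N
... | true  | true  = val*
... | true  | false =
  mapS-star (pair M) (pair (star M)) (λ _ → refl)
            (λ _ hX → ∧-intro (∧-conicalˡ _ _ h) hX) (step-star N (∧-conicalʳ _ _ h))
... | false | _     =
  mapS-star (λ X → pair X N) (λ X → pair X (star N)) (λ _ → refl)
            (λ _ hX → ∧-intro hX (∧-conicalʳ _ _ h)) (step-star M (∧-conicalˡ _ _ h))
step-star p1    _ = val*
step-star p2    _ = val*
step-star recT  _ = val*
step-star zeroT _ = val*
step-star sucT  _ = val*
step-star R     _ = samp* (λ k → sym (star-num k)) noSR-num
step-star SR    ()

sumBelow-cong : ∀ P {f g : ℕ → ℚ} → (∀ a → f a ≡ g a) → sumBelow P f ≡ sumBelow P g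
sumBelow-cong zero    e = refl
sumBelow-cong (suc P) e = cong₂ _+_ (sumBelow-cong P e) (e P)

sumBelow-zero : ∀ P → sumBelow P (λ _ → 0ℚ) ≡ 0ℚ
sumBelow-zero zero    = refl
sumBelow-zero (suc P) = trans (+-identityʳ _) (sumBelow-zero P)

sumBelow-+ : ∀ P (f g : ℕ → ℚ) → sumBelow P (λ a → f a + g a) ≡ sumBelow P f + sumBelow P g
sumBelow-+ zero    f g = sym (+-identityʳ 0ℚ)
sumBelow-+ (suc P) f g =
  trans (cong (_+ (f P + g P)) (sumBelow-+ P f g)) (interchange (sumBelow P f) (sumBelow P g) (f P) (g P))

sumBelow-swap : ∀ P Q (h : ℕ → ℕ → ℚ) →
  sumBelow P (λ a → sumBelow Q (h a)) ≡ sumBelow Q (λ b → sumBelow P (λ a → h a b))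
sumBelow-swap zero    Q h = sym (sumBelow-zero Q)
sumBelow-swap (suc P) Q h =
  trans (cong (_+ sumBelow Q (h P)) (sumBelow-swap P Q h)) (sym (sumBelow-+ Q (λ b → sumBelow P (λ a → h a b)) (h P)))

sumBelow-*ˡ : ∀ P c (f : ℕ → ℚ) → sumBelow P (λ a → c *ℚ f a) ≡ c *ℚ sumBelow P f
sumBelow-*ˡ zero    c f = sym (*-zeroʳ c)
sumBelow-*ˡ (suc P) c f =
  trans (cong (_+ (c *ℚ f P)) (sumBelow-*ˡ P c f)) (sym (*-distribˡ-+ c (sumBelow P f) (f P)))

sumBelow-mono : ∀ P {f g : ℕ → ℚ} → (∀ a → f a ≤ g a) → sumBelow P f ≤ sumBelow P g
sumBelow-mono zero    _ = ≤-refl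
sumBelow-mono (suc P) h = +-mono-≤ (sumBelow-mono P h) (h P)

p≤p+q : ∀ p {q} → 0ℚ ≤ q → p ≤ p + q
p≤p+q p h = ≤-trans (≤-reflexive (sym (+-identityʳ p))) (+-monoʳ-≤ p h)

sumBelow-nonNeg : ∀ P {f : ℕ → ℚ} → (∀ a → 0ℚ ≤ f a) → 0ℚ ≤ sumBelow P f
sumBelow-nonNeg zero    _ = ≤-refl
sumBelow-nonNeg (suc P) h = ≤-trans (sumBelow-nonNeg P h) (p≤p+q _ (h P))

sumBelow-mono-bound : ∀ {P Q} {f : ℕ → ℚ} → P ℕ.≤ Q → (∀ a → 0ℚ ≤ f a) → sumBelow P f ≤ sumBelow Q f
sumBelow-mono-bound {f = f} P≤Q h = go (ℕ.≤⇒≤′ P≤Q)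
  where
  go : ∀ {P Q} → P ℕ.≤′ Q → sumBelow P f ≤ sumBelow Q f
  go ℕ.≤′-refl         = ≤-refl
  go (ℕ.≤′-step P≤′Q) = ≤-trans (go P≤′Q) (p≤p+q _ (h _))

*-nonNeg : ∀ {p q} → 0ℚ ≤ p → 0ℚ ≤ q → 0ℚ ≤ p *ℚ q
*-nonNeg {p} {q} hp hq =
  nonNegative⁻¹ _ {{nonNeg*nonNeg⇒nonNeg p {{nonNegative hp}} q {{nonNegative hq}}}}

sumBelow²-zero : ∀ P → sumBelow P (λ _ → sumBelow P (λ _ → 0ℚ)) ≡ 0ℚ
sumBelow²-zero P = trans (sumBelow-cong P (λ _ → sumBelow-zero P)) (sumBelow-zero P)

sumBelow²-weighted-sum : ∀ P Q (c : ℕ → ℚ) (f : ℕ → ℕ → ℕ → ℚ) →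
  sumBelow P (λ a → sumBelow P (λ b → sumBelow Q (λ k → c k *ℚ f k a b)))
  ≡ sumBelow Q (λ k → c k *ℚ sumBelow P (λ a → sumBelow P (f k a)))
sumBelow²-weighted-sum P Q c f = begin
  sumBelow P (λ a → sumBelow P (λ b → sumBelow Q (λ k → c k *ℚ f k a b)))
    ≡⟨ sumBelow-cong P (λ a → sumBelow-swap P Q (λ b k → c k *ℚ f k a b)) ⟩
  sumBelow P (λ a → sumBelow Q (λ k → sumBelow P (λ b → c k *ℚ f k a b)))
    ≡⟨ sumBelow-swap P Q (λ a k → sumBelow P (λ b → c k *ℚ f k a b)) ⟩
  sumBelow Q (λ k → sumBelow P (λ a → sumBelow P (λ b → c k *ℚ f k a b)))
    ≡⟨ sumBelow-cong Q (λ k → sumBelow-cong P (λ a → sumBelow-*ˡ P (c k) (f k a))) ⟩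
  sumBelow Q (λ k → sumBelow P (λ a → c k *ℚ sumBelow P (f k a)))
    ≡⟨ sumBelow-cong Q (λ k → sumBelow-*ˡ P (c k) (λ a → sumBelow P (f k a))) ⟩
  sumBelow Q (λ k → c k *ℚ sumBelow P (λ a → sumBelow P (f k a))) ∎
  where open ≡-Reasoning

indicator-nonNeg : ∀ b → 0ℚ ≤ indicator b
indicator-nonNeg true  = nonNegative⁻¹ 1ℚ
indicator-nonNeg false = ≤-refl

indicator≤1 : ∀ b → indicator b ≤ 1ℚ
indicator≤1 true  = ≤-refl
indicator≤1 false = nonNegative⁻¹ 1ℚ

sumBelow-indicator-≡ᵇ : ∀ P n → sumBelow P (λ k → indicator (n ≡ᵇ k)) ≡ indicator (n <ᵇ P)
sumBelow-indicator-≡ᵇ zero    n = refl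
sumBelow-indicator-≡ᵇ (suc P) n = trans (cong (_+ indicator (n ≡ᵇ P)) (sumBelow-indicator-≡ᵇ P n)) (last n P)
  where
  last : ∀ n P → indicator (n <ᵇ P) + indicator (n ≡ᵇ P) ≡ indicator (n <ᵇ suc P)
  last zero    zero    = +-identityˡ 1ℚ
  last zero    (suc P) = +-identityʳ 1ℚ
  last (suc n) zero    = +-identityʳ 0ℚ
  last (suc n) (suc P) = last n P

sumBelow-indicator-∧-≡ᵇ : ∀ P c n → sumBelow P (λ k → indicator (c ∧ (n ≡ᵇ k))) ≤ indicator c
sumBelow-indicator-∧-≡ᵇ P true  n = ≤-trans (≤-reflexive (sumBelow-indicator-≡ᵇ P n)) (indicator≤1 (n <ᵇ P))
sumBelow-indicator-∧-≡ᵇ P false n = ≤-reflexive (sumBelow-zero P)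

sumBelow²-indicator≤1 : ∀ P m n → sumBelow P (λ a → sumBelow P (λ b → indicator ((m ≡ᵇ a) ∧ (n ≡ᵇ b)))) ≤ 1ℚ
sumBelow²-indicator≤1 P m n = begin
  sumBelow P (λ a → sumBelow P (λ b → indicator ((m ≡ᵇ a) ∧ (n ≡ᵇ b))))
    ≤⟨ sumBelow-mono P (λ a → sumBelow-indicator-∧-≡ᵇ P (m ≡ᵇ a) n) ⟩
  sumBelow P (λ a → indicator (m ≡ᵇ a))
    ≡⟨ sumBelow-indicator-≡ᵇ P m ⟩
  indicator (m <ᵇ P)
    ≤⟨ indicator≤1 (m <ᵇ P) ⟩
  1ℚ ∎
  where open ℚ-≤-Reasoning

halfPow-nonNeg : ∀ k → 0ℚ ≤ halfPow k
halfPow-nonNeg zero    = nonNegative⁻¹ ½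
halfPow-nonNeg (suc k) = *-nonNeg (nonNegative⁻¹ ½) (halfPow-nonNeg k)

muR-nonNeg : ∀ j P M V → 0ℚ ≤ muR j P M V
muR-nonNeg zero    P M V = indicator-nonNeg (eqTm M V)
muR-nonNeg (suc j) P M V with step M
... | val      = muR-nonNeg j P M V
... | stuck    = ≤-refl
... | det M′   = muR-nonNeg j P M′ V
... | sampR g  = sumBelow-nonNeg P (λ k → *-nonNeg (halfPow-nonNeg k) (muR-nonNeg j P (g k) V))
... | sampSR g = ≤-refl

-- The state-bounded run of M* is dominated by the truncated run of M

-- Every sample drawn in j steps from state (m , n) lies below this bound.
sampleBound : ℕ → ℕ → ℕ → ℕ
sampleBound m j n = m ℕ.+ j ℕ.* n

sampleBound-fewer-steps : ∀ m j n {P} → sampleBound m (suc j) n ℕ.≤ P → sampleBound m j n ℕ.≤ P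
sampleBound-fewer-steps m j n = ℕ.≤-trans (ℕ.+-monoʳ-≤ m (ℕ.m≤n+m (j ℕ.* n) n))

sampleBound-after-sample : ∀ m j n → sampleBound (m ℕ.+ n) j n ≡ sampleBound m (suc j) n
sampleBound-after-sample m j n = ℕ.+-assoc m n (j ℕ.* n)

module _ (V : Tm) (hV : noSR V ≡ true) (B : ℕ) where

  massSB : ℕ → Tm → ℕ → ℕ → ℚ
  massSB j X m n = sumBelow B (λ m′ → sumBelow B (λ n′ → muSB j X m n (star V) m′ n′))

  massSB≤muR : ∀ j M → noSR M ≡ true → ∀ m n P → sampleBound m j n ℕ.≤ P →
    massSB j (star M) m n ≤ muR j P M V
  massSB≤muR zero M hM m n P _ with eqTm (star M) (star V) in e
  ... | false = ≤-trans (≤-reflexive (sumBelow²-zero B)) (muR-nonNeg zero P M V)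
  ... | true rewrite eqTm-star⇒eqTm {M} {V} hM hV e = sumBelow²-indicator≤1 B m n
  massSB≤muR (suc j) M hM m n P bound
    with step M | step (star M) | step-star M hM
  ... | .val       | .val        | val*               =
    massSB≤muR j M hM m n P (sampleBound-fewer-steps m j n bound)
  ... | .stuck     | .stuck      | stuck*             = ≤-reflexive (sumBelow²-zero B)
  ... | .(det M′)  | .(det _)    | det* {M′} refl hM′ =
    massSB≤muR j M′ hM′ m n P (sampleBound-fewer-steps m j n bound)
  ... | .(sampR g) | .(sampSR h) | samp* {g} {h} h≡g* hg = begin
    sumBelow B (λ a → sumBelow B (λ b → sumBelow m (λ k → halfPow k *ℚ muSB j (h k) (m ℕ.+ n) n (star V) a b)))
      ≡⟨ sumBelow²-weighted-sum B m halfPow (λ k a b → muSB j (h k) (m ℕ.+ n) n (star V) a b) ⟩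
    sumBelow m (λ k → halfPow k *ℚ massSB j (h k) (m ℕ.+ n) n)
      ≤⟨ sumBelow-mono m (λ k → *-monoˡ-≤-nonNeg (halfPow k) {{nonNegative (halfPow-nonNeg k)}} (branch k)) ⟩
    sumBelow m (λ k → halfPow k *ℚ muR j P (g k) V)
      ≤⟨ sumBelow-mono-bound (ℕ.≤-trans (ℕ.m≤m+n m _) bound)
           (λ k → *-nonNeg (halfPow-nonNeg k) (muR-nonNeg j P (g k) V)) ⟩
    sumBelow P (λ k → halfPow k *ℚ muR j P (g k) V) ∎
    where
    open ℚ-≤-Reasoning
    branch : ∀ k → massSB j (h k) (m ℕ.+ n) n ≤ muR j P (g k) V
    branch k = ≡-subst (λ X → massSB j X (m ℕ.+ n) n ≤ muR j P (g k) V) (sym (h≡g* k))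
      (massSB≤muR j (g k) (hg k) (m ℕ.+ n) n P (≡-subst (ℕ._≤ P) (sym (sampleBound-after-sample m j n)) bound))

mainTheorem19 : (M : Tm) → ClosedTypable M → (m n : ℕ) → (V : Tm) → IsValueTR V →
    (j B : ℕ) (ε : ℚ) → 0ℚ < ε →
    ∃[ k ] ∃[ N ]
      (sumBelow B (λ m' → sumBelow B (λ n' → muSB j (star M) m n (star V) m' n'))
        ≤ muR k N M V + ε)
mainTheorem19 M (_ , ⊢M) m n V (_ , _ , hV) j B ε ε>0 =
  j , sampleBound m j n ,
  ≤-trans (massSB≤muR V hV B j M (⊢⇒noSR ⊢M) m n (sampleBound m j n) ℕ.≤-refl) (p≤p+q _ (<⇒≤ ε>0))
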